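{- Let $Q$ be an $s\times t$ $(0,1)$-matrix that is not all-zero. Then $mn-\mathrm{M}(m,n,Q)=O(m+n)$; that is, there is a constant $C$ (depending on $Q$) such that for all integers $m\ge s$, $n\ge t$, there exists an $m\times n$ strongly $Q$-forcing matrix with at most $C(m+n)$ zero entries, so $mn-\mathrm{M}(m,n,Q)\le C(m+n)$.
   Context: All matrices are $(0,1)$-matrices. An $s\times t$ submatrix of an $m\times n$ matrix is obtained by choosing any $s$ rows and any $t$ columns (not necessarily consecutive), keeping their order. For $m\ge s$, $n\ge t$, an $m\times n$ matrix $A$ is strongly $Q$-forcing if for every $1$-entry $o$ of $A$, $A$ has an $s\times t$ submatrix exactly equal to $Q$ that contains $o$. $\mathrm{M}(m,n,Q)$ is the maximum number of $1$-entries of an $m\times n$ strongly $Q$-forcing matrix. -}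

module Defs where

open import Data.Nat using (ℕ; _+_; _<_)
open import Data.Bool using (Bool; true; false)
open import Data.Fin using (Fin; toℕ)
open import Data.Product using (Σ; ∃; _×_)
open import Relation.Binary.PropositionalEquality using (_≡_)
open import Data.Vec.Functional using (foldr)

-- an m × n (0,1)-matrix: entry true = 1, false = 0
Matrix : ℕ → ℕ → Set
Matrix m n = Fin m → Fin n → Bool

Increasing : {s m : ℕ} → (Fin s → Fin m) → Set
Increasing {s} f = (a b : Fin s) → toℕ a < toℕ b → toℕ (f a) < toℕ (f b)

SubmatrixAt : {s t m n : ℕ} → Matrix s t → Matrix m n → Fin m → Fin n → Set
SubmatrixAt {s} {t} {m} {n} Q A i j =
  Σ (Fin s → Fin m) λ r → Σ (Fin t → Fin n) λ c →
    Increasing r × Increasing c ×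
    ((a : Fin s) (b : Fin t) → A (r a) (c b) ≡ Q a b) ×
    (∃ λ a → r a ≡ i) × (∃ λ b → c b ≡ j)

StronglyForcing : {s t m n : ℕ} → Matrix s t → Matrix m n → Set
StronglyForcing Q A = ∀ i j → A i j ≡ true → SubmatrixAt Q A i j

zeroCount : {m n : ℕ} → Matrix m n → ℕ
zeroCount {m} {n} A =
  foldr _+_ 0 (λ i → foldr _+_ 0 (λ j → isZero (A i j)))
  where
  isZero : Bool → ℕ
  isZero true = 0
  isZero false = 1

-- Fix a 1-entry Q a b and blow Q up to an m × n matrix by repeating row a (m − s + 1) times and
-- column b (n − t + 1) times. Every entry then lies in a copy of Q: take, among the repeated rows
-- and columns, the ones through the entry, together with the other rows and columns of Q.
-- The repeated rows meet the repeated columns in 1-entries, so all zeros lie in the s − 1 other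
-- rows or the t − 1 other columns, which gives at most (s + t)(m + n) of them.
-- The blow-up is Q reindexed along iterated pinches, each of which has two increasing sections
-- whose images together cover its domain.

module Submission where

open import Defs
open import Data.Nat using (ℕ; _+_; _*_; _≤_)
open import Data.Bool using (Bool; true)
open import Data.Fin using (Fin)
open import Data.Product using (Σ; ∃; _×_)
open import Relation.Binary.PropositionalEquality using (_≡_)

open import Data.Nat using (zero; suc; _∸_; z≤n)
open import Data.Nat.Properties
  using ( +-commutativeSemigroup; +-*-semiring; +-assoc; +-comm; +-identityʳ; *-comm; *-identityʳ; *-zeroʳ
        ; *-distribʳ-+; ≤-refl; ≤-trans; +-mono-≤; *-monoʳ-≤; m≤m+n; m≤n+m; ≰⇒>; <⇒≱; m∸n+n≡m
        ; module ≤-Reasoning)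
open import Data.Bool using (false)
open import Data.Fin using (zero; suc; inject₁; punchIn; punchOut; pinch; _≟_)
open import Data.Fin.Properties using (suc-injective; punchIn-cancel-≤; punchIn-punchOut)
open import Data.Product using (_,_; proj₁; proj₂)
open import Function using (id; _∘_)
open import Relation.Nullary using (yes; no)
open import Relation.Binary.PropositionalEquality
  using (_≢_; refl; sym; trans; cong; cong₂; subst; subst₂; module ≡-Reasoning)
open import Algebra.Properties.CommutativeSemigroup +-commutativeSemigroup using (x∙yz≈y∙xz)
open import Algebra.Properties.Semiring.Sum +-*-semiring using (sum-syntax; sum-cong-≗)

record IncreasingSectionThrough {m s : ℕ} (ρ : Fin m → Fin s) (i : Fin m) : Set where
  field
    section    : Fin s → Fin m
    increasing : Increasing section
    inverse    : ∀ x → ρ (section x) ≡ x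
    through    : ∃ λ x → section x ≡ i

open IncreasingSectionThrough

HasIncreasingSections : {m s : ℕ} → (Fin m → Fin s) → Set
HasIncreasingSections ρ = ∀ i → IncreasingSectionThrough ρ i

id-hasIncreasingSections : {n : ℕ} → HasIncreasingSections {n} id
id-hasIncreasingSections i = record
  { section = id ; increasing = λ _ _ a<b → a<b ; inverse = λ _ → refl ; through = i , refl }

∘-hasIncreasingSections : {k m s : ℕ} {ρ : Fin m → Fin s} {κ : Fin k → Fin m} →
  HasIncreasingSections ρ → HasIncreasingSections κ → HasIncreasingSections (ρ ∘ κ)
∘-hasIncreasingSections {k} {m} {s} {ρ} {κ} ρ-sections κ-sections i = record
  { section    = section K ∘ section R
  ; increasing = λ a b a<b → increasing K _ _ (increasing R a b a<b)
  ; inverse    = λ x → trans (cong ρ (inverse K (section R x))) (inverse R x)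
  ; through    = x , (begin
      section K (section R x) ≡⟨ cong (section K) Rx≡κi ⟩
      section K (κ i)         ≡⟨ cong (section K) (trans (cong κ (sym Ky≡i)) (inverse K y)) ⟩
      section K y             ≡⟨ Ky≡i ⟩
      i                       ∎)
  }
  where
  open ≡-Reasoning
  K : IncreasingSectionThrough κ i
  K = κ-sections i
  R : IncreasingSectionThrough ρ (κ i)
  R = ρ-sections (κ i)
  y : Fin m
  y = proj₁ (through K)
  Ky≡i : section K y ≡ i
  Ky≡i = proj₂ (through K)
  x : Fin s
  x = proj₁ (through R)
  Rx≡κi : section R x ≡ κ i
  Rx≡κi = proj₂ (through R)

punchIn-increasing : {n : ℕ} (p : Fin (suc n)) → Increasing (punchIn p)
punchIn-increasing p a b a<b = ≰⇒> (λ pb≤pa → <⇒≱ a<b (punchIn-cancel-≤ p b a pb≤pa))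

pinch-punchIn-suc : {n : ℕ} (i : Fin n) (j : Fin n) → pinch i (punchIn (suc i) j) ≡ j
pinch-punchIn-suc {suc n} zero    zero    = refl
pinch-punchIn-suc {suc n} zero    (suc j) = refl
pinch-punchIn-suc {suc n} (suc i) zero    = refl
pinch-punchIn-suc {suc n} (suc i) (suc j) = cong suc (pinch-punchIn-suc i j)

pinch-punchIn-inject₁ : {n : ℕ} (i : Fin n) (j : Fin n) → pinch i (punchIn (inject₁ i) j) ≡ j
pinch-punchIn-inject₁ {suc n} zero    j       = refl
pinch-punchIn-inject₁ {suc n} (suc i) zero    = refl
pinch-punchIn-inject₁ {suc n} (suc i) (suc j) = cong suc (pinch-punchIn-inject₁ i j)

pinch-inject₁ : {n : ℕ} (i : Fin n) → pinch i (inject₁ i) ≡ i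
pinch-inject₁ {suc n} zero    = refl
pinch-inject₁ {suc n} (suc i) = cong suc (pinch-inject₁ i)

inject₁≢suc : {n : ℕ} (i : Fin n) → inject₁ i ≢ suc i
inject₁≢suc zero    ()
inject₁≢suc (suc i) eq = inject₁≢suc i (suc-injective eq)

punchIn-sectionThrough : {n : ℕ} {ρ : Fin (suc n) → Fin n} (p : Fin (suc n)) {j : Fin (suc n)} →
  (∀ x → ρ (punchIn p x) ≡ x) → p ≢ j → IncreasingSectionThrough ρ j
punchIn-sectionThrough p ρ∘punchIn≗id p≢j = record
  { section    = punchIn p
  ; increasing = punchIn-increasing p
  ; inverse    = ρ∘punchIn≗id
  ; through    = punchOut p≢j , punchIn-punchOut p≢j
  }

pinch-hasIncreasingSections : {n : ℕ} (i : Fin n) → HasIncreasingSections (pinch i)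
pinch-hasIncreasingSections i j with j ≟ suc i
... | yes refl  = punchIn-sectionThrough (inject₁ i) (pinch-punchIn-inject₁ i) (inject₁≢suc i)
... | no j≢suci = punchIn-sectionThrough (suc i) (pinch-punchIn-suc i) (j≢suci ∘ sym)

reindex : {s t m n : ℕ} → Matrix s t → (Fin m → Fin s) → (Fin n → Fin t) → Matrix m n
reindex Q ρ κ i j = Q (ρ i) (κ j)

-- The hypothesis that the entry is 1 is not needed: every entry lies in a copy of Q.
reindex-stronglyForcing : {s t m n : ℕ} (Q : Matrix s t) {ρ : Fin m → Fin s} {κ : Fin n → Fin t} →
  HasIncreasingSections ρ → HasIncreasingSections κ → StronglyForcing Q (reindex Q ρ κ)
reindex-stronglyForcing Q {ρ} {κ} ρ-sections κ-sections i j _ =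
  section R , section K , increasing R , increasing K ,
  (λ x y → cong₂ Q (inverse R x) (inverse K y)) , through R , through K
  where
  R : IncreasingSectionThrough ρ i
  R = ρ-sections i
  K : IncreasingSectionThrough κ j
  K = κ-sections j

inject+′ : {s : ℕ} (d : ℕ) → Fin s → Fin (d + s)
inject+′ zero    a = a
inject+′ (suc d) a = inject₁ (inject+′ d a)

collapse : {s : ℕ} → Fin s → (d : ℕ) → Fin (d + s) → Fin s
collapse a zero    = id
collapse a (suc d) = collapse a d ∘ pinch (inject+′ d a)

collapse-inject+′ : {s : ℕ} (a : Fin s) (d : ℕ) → collapse a d (inject+′ d a) ≡ a
collapse-inject+′ a zero    = refl
collapse-inject+′ a (suc d) =
  trans (cong (collapse a d) (pinch-inject₁ (inject+′ d a))) (collapse-inject+′ a d)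

collapse-hasIncreasingSections : {s : ℕ} (a : Fin s) (d : ℕ) → HasIncreasingSections (collapse a d)
collapse-hasIncreasingSections a zero    = id-hasIncreasingSections
collapse-hasIncreasingSections a (suc d) =
  ∘-hasIncreasingSections (collapse-hasIncreasingSections a d) (pinch-hasIncreasingSections (inject+′ d a))

∑-pinch : {n : ℕ} (i : Fin n) (f : Fin n → ℕ) → ∑[ j < suc n ] f (pinch i j) ≡ f i + ∑[ j < n ] f j
∑-pinch {suc n} zero    f = refl
∑-pinch {suc n} (suc i) f = begin
  f zero + ∑[ j < suc n ] f (suc (pinch i j))  ≡⟨ cong (f zero +_) (∑-pinch i (f ∘ suc)) ⟩
  f zero + (f (suc i) + ∑[ j < n ] f (suc j))  ≡⟨ x∙yz≈y∙xz (f zero) (f (suc i)) _ ⟩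
  f (suc i) + (f zero + ∑[ j < n ] f (suc j))  ∎
  where open ≡-Reasoning

∑-collapse : {s : ℕ} (a : Fin s) (d : ℕ) (f : Fin s → ℕ) →
  ∑[ j < d + s ] f (collapse a d j) ≡ d * f a + ∑[ x < s ] f x
∑-collapse a zero    f = refl
∑-collapse {s} a (suc d) f = begin
  ∑[ j < suc d + s ] f (collapse a d (pinch (inject+′ d a) j))
    ≡⟨ ∑-pinch (inject+′ d a) (f ∘ collapse a d) ⟩
  f (collapse a d (inject+′ d a)) + ∑[ j < d + s ] f (collapse a d j)
    ≡⟨ cong₂ _+_ (cong f (collapse-inject+′ a d)) (∑-collapse a d f) ⟩
  f a + (d * f a + ∑[ x < s ] f x)
    ≡⟨ sym (+-assoc (f a) (d * f a) _) ⟩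
  suc d * f a + ∑[ x < s ] f x
    ∎
  where open ≡-Reasoning

∑-≤ : {n c : ℕ} (f : Fin n → ℕ) → (∀ i → f i ≤ c) → ∑[ i < n ] f i ≤ n * c
∑-≤ {zero}  f f≤c = z≤n
∑-≤ {suc n} f f≤c = +-mono-≤ (f≤c zero) (∑-≤ (f ∘ suc) (f≤c ∘ suc))

-- The indicator inside zeroCount is local to its definition; this recovers it up to two "+ 0".
zeroIndicator : Bool → ℕ
zeroIndicator b = zeroCount {1} {1} (λ _ _ → b)

zeroIndicator≤1 : (b : Bool) → zeroIndicator b ≤ 1
zeroIndicator≤1 true  = z≤n
zeroIndicator≤1 false = ≤-refl

zeroCount≡∑∑ : {m n : ℕ} (A : Matrix m n) → zeroCount A ≡ ∑[ i < m ] ∑[ j < n ] zeroIndicator (A i j)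
zeroCount≡∑∑ {m} {n} A =
  sum-cong-≗ {m} λ i → sum-cong-≗ {n} λ j → sym (trans (+-identityʳ _) (+-identityʳ _))

module _ {s t : ℕ} (Q : Matrix s t) {a : Fin s} {b : Fin t} (Qab≡1 : Q a b ≡ true) (d e : ℕ) where

  private
    zerosInRow : Fin s → ℕ
    zerosInRow x = ∑[ j < e + t ] zeroIndicator (Q x (collapse b e j))

    zerosInRow≤ : ∀ x → zerosInRow x ≤ e + t
    zerosInRow≤ x =
      subst (zerosInRow x ≤_) (*-identityʳ (e + t)) (∑-≤ _ (zeroIndicator≤1 ∘ Q x ∘ collapse b e))

    zerosInRow-a≤ : zerosInRow a ≤ t
    zerosInRow-a≤ = begin
      zerosInRow a
        ≡⟨ ∑-collapse b e (zeroIndicator ∘ Q a) ⟩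
      e * zeroIndicator (Q a b) + zerosOfQ
        ≡⟨ cong (λ z → e * zeroIndicator z + zerosOfQ) Qab≡1 ⟩
      e * 0 + zerosOfQ
        ≡⟨ cong (_+ zerosOfQ) (*-zeroʳ e) ⟩
      zerosOfQ
        ≤⟨ subst (zerosOfQ ≤_) (*-identityʳ t) (∑-≤ _ (zeroIndicator≤1 ∘ Q a)) ⟩
      t ∎
      where
      open ≤-Reasoning
      zerosOfQ : ℕ
      zerosOfQ = ∑[ y < t ] zeroIndicator (Q a y)

  zeroCount-reindex-collapse :
    zeroCount (reindex Q (collapse a d) (collapse b e)) ≤ d * t + s * (e + t)
  zeroCount-reindex-collapse = begin
    zeroCount (reindex Q (collapse a d) (collapse b e))
      ≡⟨ zeroCount≡∑∑ (reindex Q (collapse a d) (collapse b e)) ⟩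
    ∑[ i < d + s ] zerosInRow (collapse a d i)
      ≡⟨ ∑-collapse a d zerosInRow ⟩
    d * zerosInRow a + ∑[ x < s ] zerosInRow x
      ≤⟨ +-mono-≤ (*-monoʳ-≤ d zerosInRow-a≤) (∑-≤ zerosInRow zerosInRow≤) ⟩
    d * t + s * (e + t) ∎
    where open ≤-Reasoning

stretch-bound : (s t d e : ℕ) → d * t + s * (e + t) ≤ (s + t) * ((d + s) + (e + t))
stretch-bound s t d e = begin
  d * t + s * (e + t)    ≡⟨ cong (_+ s * (e + t)) (*-comm d t) ⟩
  t * d + s * (e + t)    ≤⟨ +-mono-≤ (*-monoʳ-≤ t d≤N) (*-monoʳ-≤ s (m≤n+m (e + t) (d + s))) ⟩
  t * N + s * N          ≡⟨ +-comm (t * N) (s * N) ⟩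
  s * N + t * N          ≡⟨ sym (*-distribʳ-+ N s t) ⟩
  (s + t) * N            ∎
  where
  open ≤-Reasoning
  N : ℕ
  N = (d + s) + (e + t)
  d≤N : d ≤ N
  d≤N = ≤-trans (m≤m+n d s) (m≤m+n (d + s) (e + t))

lemma4 : (s t : ℕ) (Q : Matrix s t) →
    (∃ λ a → ∃ λ b → Q a b ≡ true) →
    ∃ λ C → (m n : ℕ) → s ≤ m → t ≤ n →
    Σ (Matrix m n) λ A → StronglyForcing Q A × zeroCount A ≤ C * (m + n)
lemma4 s t Q (a , b , Qab≡1) = s + t , λ m n s≤m t≤n →
  subst₂ Witness (m∸n+n≡m s≤m) (m∸n+n≡m t≤n) (stretched (m ∸ s) (n ∸ t))
  where
  Witness : ℕ → ℕ → Set
  Witness m n = Σ (Matrix m n) λ A → StronglyForcing Q A × zeroCount A ≤ (s + t) * (m + n)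

  stretched : (d e : ℕ) → Witness (d + s) (e + t)
  stretched d e =
    reindex Q (collapse a d) (collapse b e) ,
    reindex-stronglyForcing Q (collapse-hasIncreasingSections a d) (collapse-hasIncreasingSections b e) ,
    ≤-trans (zeroCount-reindex-collapse Q Qab≡1 d e) (stretch-bound s t d e)
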